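{- Let $A=[a_{st}]\in\mathcal{PM}(n)$, $B\in\mathcal{PM}(m)$ and $i\in[n]$. Write $A_{11}=A[\{1,\dots,i-1\}]$, $A_{22}=A[\{i+1,\dots,n\}]$ and $A_{21}=A[\{i+1,\dots,n\}\mid\{1,\dots,i-1\}]$. Let $U$ be an $m\times(i-1)$ matrix and $V$ an $(n-i)\times m$ matrix, and let $C$ be the $(n+m-1)\times(n+m-1)$ matrix $$C=\begin{pmatrix}A_{11}&\mathbb{O}&\mathbb{O}\\ U&B&\mathbb{O}\\ A_{21}&V&A_{22}\end{pmatrix}.$$ Suppose that the triple $(U,V,A_{21})$ is one of the following seven triples (where $\mathbb{J}$ is the all-ones matrix and $\mathbb{O}$ the zero matrix of the appropriate size): $(\mathbb{J},\mathbb{J},\mathbb{J})$, $(\mathbb{O},\mathbb{O},\mathbb{J})$, $(\mathbb{J},\mathbb{O},\mathbb{J})$, $(\mathbb{O},\mathbb{J},\mathbb{J})$, $(\mathbb{O},\mathbb{O},\mathbb{O})$, $(\mathbb{O},\mathbb{J},\mathbb{O})$, $(\mathbb{J},\mathbb{O},\mathbb{O})$. Then in all seven cases $C$ is a poset matrix, i.e. $C\in\mathcal{PM}(n+m-1)$.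
   Context: A poset matrix of order $n$ is an $n\times n$ $(0,1)$-matrix $A=[a_{st}]$ that is lower triangular with all diagonal entries equal to $1$ and is transitive: $a_{st}=1$ and $a_{tu}=1$ imply $a_{su}=1$. $\mathcal{PM}(n)$ denotes the set of all $n\times n$ poset matrices. For index sets $\alpha,\beta$, $A[\alpha\mid\beta]$ is the submatrix with rows in $\alpha$ and columns in $\beta$ (in increasing order), and $A[\alpha]=A[\alpha\mid\alpha]$. Blocks with no rows or no columns (e.g. when $i=1$ or $i=n$) are vacuous. -}

module Defs where

open import Data.Bool using (Bool; true; false)
open import Data.Nat using (ℕ; zero; suc; _+_; _∸_; _<_; _≤_; _<?_)
open import Data.Fin using (Fin; toℕ; fromℕ<)
open import Data.Product using (_×_)
open import Data.Sum using (_⊎_)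
open import Relation.Nullary using (yes; no)
open import Relation.Binary.PropositionalEquality using (_≡_)

-- A (0,1)-matrix with p rows and q columns; entries are Booleans
-- (true = 1, false = 0).  Indices are 0-based (Fin p, Fin q).
Mat : ℕ → ℕ → Set
Mat p q = Fin p → Fin q → Bool

IsPosetMatrix : (n : ℕ) → Mat n n → Set
IsPosetMatrix n A =
  (∀ s t → toℕ s < toℕ t → A s t ≡ false) ×
  (∀ s → A s s ≡ true) ×
  (∀ s t u → A s t ≡ true → A t u ≡ true → A s u ≡ true)

-- Entry lookup by natural-number indices; out of range gives 0 (false).
-- (Only ever used in range below.)
entry : ∀ {p q} → Mat p q → ℕ → ℕ → Bool
entry {p} {q} M r c with r <? p | c <? q
... | yes r<p | yes c<q = M (fromℕ< r<p) (fromℕ< c<q)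
... | _ | _ = false

-- The block matrix
--        ( A11  O   O   )
--   C =  ( U    B   O   )
--        ( A21  V   A22 )
-- of order n + m - 1, where i is the 1-based index (toℕ i + 1),
-- k = toℕ i = i - 1 is the size of A11, U is m × (i-1) and
-- V is (n-i) × m.
blockEntry : ∀ {n m} (A : Mat n n) (B : Mat m m) (i : Fin n)
  (U : Mat m (toℕ i)) (V : Mat (n ∸ suc (toℕ i)) m) → ℕ → ℕ → Bool
blockEntry {n} {m} A B i U V r c with r <? toℕ i | r <? toℕ i + m | c <? toℕ i | c <? toℕ i + m
... | yes _ | _     | yes _ | _     = entry A r c
... | yes _ | _     | no _  | _     = false
... | no _  | yes _ | yes _ | _     = entry U (r ∸ toℕ i) c
... | no _  | yes _ | no _  | yes _ = entry B (r ∸ toℕ i) (c ∸ toℕ i)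
... | no _  | yes _ | no _  | no _  = false
... | no _  | no _  | yes _ | _     = entry A (r + 1 ∸ m) c
... | no _  | no _  | no _  | yes _ = entry V (r ∸ (toℕ i + m)) (c ∸ toℕ i)
... | no _  | no _  | no _  | no _  = entry A (r + 1 ∸ m) (c + 1 ∸ m)

blockMatrix : ∀ {n m} (A : Mat n n) (B : Mat m m) (i : Fin n)
  (U : Mat m (toℕ i)) (V : Mat (n ∸ suc (toℕ i)) m) → Mat (n + m ∸ 1) (n + m ∸ 1)
blockMatrix A B i U V r c = blockEntry A B i U V (toℕ r) (toℕ c)

IsJ : ∀ {p q} → Mat p q → Set
IsJ M = ∀ a b → M a b ≡ true

IsO : ∀ {p q} → Mat p q → Set
IsO M = ∀ a b → M a b ≡ false

-- A21 = A[{i+1..n} | {1..i-1}] (1-based), i.e. 0-based rows s > toℕ i, cols t < toℕ i.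
A21IsJ : ∀ {n} → Mat n n → Fin n → Set
A21IsJ A i = ∀ s t → toℕ i < toℕ s → toℕ t < toℕ i → A s t ≡ true

A21IsO : ∀ {n} → Mat n n → Fin n → Set
A21IsO A i = ∀ s t → toℕ i < toℕ s → toℕ t < toℕ i → A s t ≡ false

SevenCases : ∀ {n m} (A : Mat n n) (i : Fin n)
  (U : Mat m (toℕ i)) (V : Mat (n ∸ suc (toℕ i)) m) → Set
SevenCases A i U V =
  (IsJ U × IsJ V × A21IsJ A i) ⊎
  (IsO U × IsO V × A21IsJ A i) ⊎
  (IsJ U × IsO V × A21IsJ A i) ⊎
  (IsO U × IsJ V × A21IsJ A i) ⊎
  (IsO U × IsO V × A21IsO A i) ⊎
  (IsO U × IsJ V × A21IsO A i) ⊎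
  (IsJ U × IsO V × A21IsO A i)

{-# OPTIONS --safe #-}
-- Index C by blocks (top = A₁₁, mid = B, bot = A₂₂); restricted to top ∪ bot it is A,
-- restricted to mid it is B, so it is lower triangular with unit diagonal.  In a chain
-- C[r,c] = C[c,e] = 1 every step goes weakly down the blocks.  Chains inside top ∪ bot or
-- inside mid are handled by the transitivity of A or B; chains ending or starting in the
-- U- or V-block stay there because a constant matrix with a 1 is all ones.  The only new
-- chain is bot → mid → top, through V[d,j] = U[j,t] = 1, and it needs A₂₁[d,t] = 1: that
-- is VU ≤ A₂₁, which among the eight constant triples fails only for (J, J, O).
module Submission where

open import Defs
open import Data.Bool using (Bool; true; false)
open import Data.Bool.Properties using (¬-not)
open import Data.Fin using (Fin; toℕ; fromℕ<)
open import Data.Fin.Properties using (toℕ<n; toℕ-fromℕ<)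
open import Data.Nat using (ℕ; suc; _+_; _∸_; _<_; _≤_; _<?_; s≤s)
open import Data.Nat.Properties
open import Data.Nat.Tactic.RingSolver using (solve-∀)
open import Data.Product using (_×_; _,_)
open import Data.Sum using (_⊎_; inj₁; inj₂)
open import Relation.Nullary using (¬_; yes; no; contradiction)
open import Relation.Nullary.Decidable using (dec-yes-irr; dec-no)
open import Relation.Binary.PropositionalEquality

private
  variable
    p q r c e : ℕ

<?-yes : (r<c : r < c) → (r <? c) ≡ yes r<c
<?-yes r<c = dec-yes-irr (_ <? _) <-irrelevant r<c

<?-no : (r≮c : ¬ r < c) → (r <? c) ≡ no r≮c
<?-no = dec-no (_ <? _)

m+n<o⇒n<o∸m : ∀ m n o → m + n < o → n < o ∸ m
m+n<o⇒n<o∸m m n o m+n<o =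
  subst (_< o ∸ m) (m+n∸m≡n m n) (∸-monoˡ-< m+n<o (m≤m+n m n))

n<o∸m⇒m+n<o : ∀ m n o → m ≤ o → n < o ∸ m → m + n < o
n<o∸m⇒m+n<o m n o m≤o n<o∸m = subst (m + n <_) (m+[n∸m]≡n m≤o) (+-monoʳ-< m n<o∸m)

k+m+d+1∸m≡1+k+d : ∀ k m d → k + m + d + 1 ∸ m ≡ suc (k + d)
k+m+d+1∸m≡1+k+d k m d = begin
  k + m + d + 1 ∸ m    ≡⟨ cong (_∸ m) (k+m+d+1≡1+k+d+m k m d) ⟩
  suc (k + d) + m ∸ m  ≡⟨ m+n∸n≡m (suc (k + d)) m ⟩
  suc (k + d)          ∎
  where
  open ≡-Reasoning
  k+m+d+1≡1+k+d+m : ∀ k m d → k + m + d + 1 ≡ suc (k + d) + m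
  k+m+d+1≡1+k+d+m = solve-∀

k+m+d<n+m∸1⇒1+k+d<n : ∀ {n} k m d → k < n → k + m + d < n + m ∸ 1 → suc (k + d) < n
k+m+d<n+m∸1⇒1+k+d<n {suc n} k m d _ lt =
  s≤s (+-cancelʳ-< m (k + d) n (subst (_< n + m) (+-right-comm k m d) lt))
  where
  +-right-comm : ∀ k m d → k + m + d ≡ k + d + m
  +-right-comm = solve-∀

module _ (M : Mat p q) where

  entry-fromℕ< : (r<p : r < p) (c<q : c < q) → entry M r c ≡ M (fromℕ< r<p) (fromℕ< c<q)
  entry-fromℕ< {r} {c} r<p c<q rewrite <?-yes r<p | <?-yes c<q = refl

  entry≡true⇒inBounds : entry M r c ≡ true → r < p × c < q
  entry≡true⇒inBounds {r} {c} h with r <? p | c <? q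
  ... | yes r<p | yes c<q = r<p , c<q

IsConstant : Mat p q → Set
IsConstant M = IsJ M ⊎ IsO M

IsO⇒entry≢true : {M : Mat p q} → IsO M → ¬ entry M r c ≡ true
IsO⇒entry≢true {M = M} O h with r<p , c<q ← entry≡true⇒inBounds M h =
  contradiction (trans (sym (O _ _)) (trans (sym (entry-fromℕ< M r<p c<q)) h)) λ ()

IsConstant⇒entry≡true : {M : Mat p q} → IsConstant M →
  ∀ {a b} → entry M a b ≡ true → r < p → c < q → entry M r c ≡ true
IsConstant⇒entry≡true {M = M} (inj₁ J) _ r<p c<q = trans (entry-fromℕ< M r<p c<q) (J _ _)
IsConstant⇒entry≡true (inj₂ O) h _ _ = contradiction h (IsO⇒entry≢true O)

module _ {M : Mat p p} where

  entry-lower : IsPosetMatrix p M → r < c → entry M r c ≡ false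
  entry-lower {r} {c} (lower , _) r<c with r <? p | c <? p
  ... | yes r<p | yes c<p =
    lower _ _ (subst₂ _<_ (sym (toℕ-fromℕ< r<p)) (sym (toℕ-fromℕ< c<p)) r<c)
  ... | yes _ | no _ = refl
  ... | no _  | _    = refl

  entry-refl : IsPosetMatrix p M → r < p → entry M r r ≡ true
  entry-refl (_ , diagonal , _) r<p = trans (entry-fromℕ< M r<p r<p) (diagonal _)

  entry-trans : IsPosetMatrix p M → entry M r c ≡ true → entry M c e ≡ true → entry M r e ≡ true
  entry-trans (_ , _ , transitive) h₁ h₂ =
    let r<p , c<p = entry≡true⇒inBounds M h₁ ; _ , e<p = entry≡true⇒inBounds M h₂ in
    trans (entry-fromℕ< M r<p e<p)
      (transitive _ _ _ (trans (sym (entry-fromℕ< M r<p c<p)) h₁) (trans (sym (entry-fromℕ< M c<p e<p)) h₂))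

-- Row d of A₂₁ is row suc (toℕ i + d) of A, as in the third block row of blockEntry.
VU≤A21 : ∀ {n m} (A : Mat n n) (i : Fin n) (U : Mat m (toℕ i)) (V : Mat (n ∸ suc (toℕ i)) m) → Set
VU≤A21 A i U V =
  ∀ {d j t} → entry V d j ≡ true → entry U j t ≡ true → entry A (suc (toℕ i + d)) t ≡ true

Admissible : ∀ {n m} (A : Mat n n) (i : Fin n) (U : Mat m (toℕ i)) (V : Mat (n ∸ suc (toℕ i)) m) → Set
Admissible A i U V = IsConstant U × IsConstant V × VU≤A21 A i U V

module BlockMatrix {n m} (A : Mat n n) (B : Mat m m) (i : Fin n)
  (U : Mat m (toℕ i)) (V : Mat (n ∸ suc (toℕ i)) m) where

  private
    k = toℕ i
    C = blockEntry A B i U V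

  data Position : ℕ → Set where
    top : ∀ r → r < k → Position r
    mid : ∀ j → j < m → Position (k + j)
    bot : ∀ d → d < n ∸ suc k → Position (k + m + d)

  position : ∀ r → r < n + m ∸ 1 → Position r
  position r r<N with r <? k | r <? k + m
  ... | yes r<k | _ = top r r<k
  ... | no r≮k | yes r<k+m with j , refl ← m≤n⇒∃[o]m+o≡n (≮⇒≥ r≮k) =
    mid j (+-cancelˡ-< k j m r<k+m)
  ... | no _ | no r≮k+m with d , refl ← m≤n⇒∃[o]m+o≡n (≮⇒≥ r≮k+m) =
    bot d (m+n<o⇒n<o∸m (suc k) d n (k+m+d<n+m∸1⇒1+k+d<n k m d (toℕ<n i) r<N))

  cell : Position r → Position c → Bool
  cell (top r _) (top c _) = entry A r c
  cell (top _ _) (mid _ _) = false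
  cell (top _ _) (bot _ _) = false
  cell (mid j _) (top c _) = entry U j c
  cell (mid j _) (mid j′ _) = entry B j j′
  cell (mid _ _) (bot _ _) = false
  cell (bot d _) (top c _) = entry A (suc (k + d)) c
  cell (bot d _) (mid j _) = entry V d j
  cell (bot d _) (bot d′ _) = entry A (suc (k + d)) (suc (k + d′))

  k+j≮k : ∀ j → ¬ k + j < k
  k+j≮k = m+n≮m k

  k+m+d≮k+m : ∀ d → ¬ k + m + d < k + m
  k+m+d≮k+m = m+n≮m (k + m)

  k+m+d≮k : ∀ d → ¬ k + m + d < k
  k+m+d≮k d lt = k+m+d≮k+m d (<-≤-trans lt (m≤m+n k m))

  blockEntry≡cell : (pr : Position r) (pc : Position c) → C r c ≡ cell pr pc
  blockEntry≡cell (top r r<k) (top c c<k)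
    rewrite <?-yes r<k | <?-yes c<k = refl
  blockEntry≡cell (top r r<k) (mid j _)
    rewrite <?-yes r<k | <?-no (k+j≮k j) = refl
  blockEntry≡cell (top r r<k) (bot d _)
    rewrite <?-yes r<k | <?-no (k+m+d≮k d) = refl
  -- c <? k is rewritten twice: once more inside entry U, which only appears after the rows reduce.
  blockEntry≡cell (mid j j<m) (top c c<k)
    rewrite <?-no (k+j≮k j) | <?-yes (+-monoʳ-< k j<m) | <?-yes c<k | m+n∸m≡n k j
          | <?-yes c<k = refl
  blockEntry≡cell (mid j j<m) (mid j′ j′<m)
    rewrite <?-no (k+j≮k j) | <?-yes (+-monoʳ-< k j<m)
          | <?-no (k+j≮k j′) | <?-yes (+-monoʳ-< k j′<m) | m+n∸m≡n k j | m+n∸m≡n k j′ = refl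
  blockEntry≡cell (mid j j<m) (bot d _)
    rewrite <?-no (k+j≮k j) | <?-yes (+-monoʳ-< k j<m)
          | <?-no (k+m+d≮k d) | <?-no (k+m+d≮k+m d) = refl
  blockEntry≡cell (bot d _) (top c c<k)
    rewrite <?-no (k+m+d≮k d) | <?-no (k+m+d≮k+m d) | <?-yes c<k | k+m+d+1∸m≡1+k+d k m d = refl
  blockEntry≡cell (bot d _) (mid j j<m)
    rewrite <?-no (k+m+d≮k d) | <?-no (k+m+d≮k+m d)
          | <?-no (k+j≮k j) | <?-yes (+-monoʳ-< k j<m) | m+n∸m≡n (k + m) d | m+n∸m≡n k j = refl
  blockEntry≡cell (bot d _) (bot d′ _)
    rewrite <?-no (k+m+d≮k d) | <?-no (k+m+d≮k+m d)
          | <?-no (k+m+d≮k d′) | <?-no (k+m+d≮k+m d′)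
          | k+m+d+1∸m≡1+k+d k m d | k+m+d+1∸m≡1+k+d k m d′ = refl

  module _ (PA : IsPosetMatrix n A) (PB : IsPosetMatrix m B)
    (U-constant : IsConstant U) (V-constant : IsConstant V) (VU≤A₂₁ : VU≤A21 A i U V) where

    cell-lower : (pr : Position r) (pc : Position c) → r < c → cell pr pc ≡ false
    cell-lower (top _ _) (top _ _) r<c = entry-lower PA r<c
    cell-lower (top _ _) (mid _ _) _ = refl
    cell-lower (top _ _) (bot _ _) _ = refl
    cell-lower (mid j _) (top _ c<k) r<c = contradiction (<-trans r<c c<k) (k+j≮k j)
    cell-lower (mid _ _) (mid _ _) r<c = entry-lower PB (+-cancelˡ-< k _ _ r<c)
    cell-lower (mid _ _) (bot _ _) _ = refl
    cell-lower (bot d _) (top _ c<k) r<c = contradiction (<-trans r<c c<k) (k+m+d≮k d)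
    cell-lower (bot d _) (mid _ j<m) r<c = contradiction (<-trans r<c (+-monoʳ-< k j<m)) (k+m+d≮k+m d)
    cell-lower (bot _ _) (bot _ _) r<c = entry-lower PA (s≤s (+-monoʳ-< k (+-cancelˡ-< (k + m) _ _ r<c)))

    cell-refl : (pr : Position r) → cell pr pr ≡ true
    cell-refl (top _ r<k) = entry-refl PA (<-trans r<k (toℕ<n i))
    cell-refl (mid _ j<m) = entry-refl PB j<m
    cell-refl (bot d d<) = entry-refl PA (n<o∸m⇒m+n<o (suc k) d n (toℕ<n i) d<)

    cell-trans : (pr : Position r) (pc : Position c) (pe : Position e) →
                 cell pr pc ≡ true → cell pc pe ≡ true → cell pr pe ≡ true
    cell-trans (top _ _) (mid _ _) _ () _
    cell-trans (top _ _) (bot _ _) _ () _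
    cell-trans (mid _ _) (bot _ _) _ () _
    cell-trans _ (top _ _) (mid _ _) _ ()
    cell-trans _ (top _ _) (bot _ _) _ ()
    cell-trans _ (mid _ _) (bot _ _) _ ()
    cell-trans (top _ _) (top _ _) (top _ _) h₁ h₂ = entry-trans PA h₁ h₂
    cell-trans (mid _ j<m) (top _ _) (top _ e<k) h₁ _ = IsConstant⇒entry≡true U-constant h₁ j<m e<k
    cell-trans (mid _ j<m) (mid _ _) (top _ e<k) _ h₂ = IsConstant⇒entry≡true U-constant h₂ j<m e<k
    cell-trans (mid _ _) (mid _ _) (mid _ _) h₁ h₂ = entry-trans PB h₁ h₂
    cell-trans (bot _ _) (top _ _) (top _ _) h₁ h₂ = entry-trans PA h₁ h₂
    cell-trans (bot _ _) (mid _ _) (top _ _) h₁ h₂ = VU≤A₂₁ h₁ h₂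
    cell-trans (bot _ d<) (mid _ _) (mid _ j′<m) h₁ _ = IsConstant⇒entry≡true V-constant h₁ d< j′<m
    cell-trans (bot _ _) (bot _ _) (top _ _) h₁ h₂ = entry-trans PA h₁ h₂
    cell-trans (bot _ d<) (bot _ _) (mid _ j<m) _ h₂ = IsConstant⇒entry≡true V-constant h₂ d< j<m
    cell-trans (bot _ _) (bot _ _) (bot _ _) h₁ h₂ = entry-trans PA h₁ h₂

    isPosetMatrix : IsPosetMatrix (n + m ∸ 1) (blockMatrix A B i U V)
    isPosetMatrix =
        (λ s t s<t → trans (blockEntry≡cell (pos s) (pos t)) (cell-lower (pos s) (pos t) s<t))
      , (λ s → trans (blockEntry≡cell (pos s) (pos s)) (cell-refl (pos s)))
      , (λ s t u h₁ h₂ → trans (blockEntry≡cell (pos s) (pos u))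
          (cell-trans (pos s) (pos t) (pos u)
            (trans (sym (blockEntry≡cell (pos s) (pos t))) h₁)
            (trans (sym (blockEntry≡cell (pos t) (pos u))) h₂)))
      where
      pos : (s : Fin (n + m ∸ 1)) → Position (toℕ s)
      pos s = position (toℕ s) (toℕ<n s)

blockMatrix-isPosetMatrix : ∀ {n m} {A : Mat n n} {B : Mat m m} {i : Fin n}
  {U : Mat m (toℕ i)} {V : Mat (n ∸ suc (toℕ i)) m} →
  IsPosetMatrix n A → IsPosetMatrix m B → Admissible A i U V →
  IsPosetMatrix (n + m ∸ 1) (blockMatrix A B i U V)
blockMatrix-isPosetMatrix {A = A} {B} {i} {U} {V} PA PB (U-constant , V-constant , VU≤A₂₁) =
  BlockMatrix.isPosetMatrix A B i U V PA PB U-constant V-constant VU≤A₂₁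

module _ {n m} {A : Mat n n} {i : Fin n} {U : Mat m (toℕ i)} {V : Mat (n ∸ suc (toℕ i)) m} where

  A21IsJ⇒VU≤A21 : A21IsJ A i → VU≤A21 A i U V
  A21IsJ⇒VU≤A21 A₂₁-ones {d} hV hU =
    let d< , _ = entry≡true⇒inBounds V hV ; _ , t<k = entry≡true⇒inBounds U hU
        row<n = n<o∸m⇒m+n<o (suc (toℕ i)) d n (toℕ<n i) d<
        t<n = <-trans t<k (toℕ<n i)
    in trans (entry-fromℕ< A row<n t<n)
         (A₂₁-ones _ _ (subst (toℕ i <_) (sym (toℕ-fromℕ< row<n)) (s≤s (m≤m+n (toℕ i) d)))
                       (subst (_< toℕ i) (sym (toℕ-fromℕ< t<n)) t<k))

  IsO-U⇒VU≤A21 : IsO U → VU≤A21 A i U V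
  IsO-U⇒VU≤A21 U-zero _ hU = contradiction hU (IsO⇒entry≢true U-zero)

  IsO-V⇒VU≤A21 : IsO V → VU≤A21 A i U V
  IsO-V⇒VU≤A21 V-zero hV _ = contradiction hV (IsO⇒entry≢true V-zero)

  sevenCases⇒admissible : SevenCases A i U V → Admissible A i U V
  sevenCases⇒admissible (inj₁ (uJ , vJ , aJ))
    = inj₁ uJ , inj₁ vJ , A21IsJ⇒VU≤A21 aJ
  sevenCases⇒admissible (inj₂ (inj₁ (uO , vO , aJ)))
    = inj₂ uO , inj₂ vO , A21IsJ⇒VU≤A21 aJ
  sevenCases⇒admissible (inj₂ (inj₂ (inj₁ (uJ , vO , aJ))))
    = inj₁ uJ , inj₂ vO , A21IsJ⇒VU≤A21 aJ
  sevenCases⇒admissible (inj₂ (inj₂ (inj₂ (inj₁ (uO , vJ , aJ)))))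
    = inj₂ uO , inj₁ vJ , A21IsJ⇒VU≤A21 aJ
  sevenCases⇒admissible (inj₂ (inj₂ (inj₂ (inj₂ (inj₁ (uO , vO , _))))))
    = inj₂ uO , inj₂ vO , IsO-U⇒VU≤A21 uO
  sevenCases⇒admissible (inj₂ (inj₂ (inj₂ (inj₂ (inj₂ (inj₁ (uO , vJ , _)))))))
    = inj₂ uO , inj₁ vJ , IsO-U⇒VU≤A21 uO
  sevenCases⇒admissible (inj₂ (inj₂ (inj₂ (inj₂ (inj₂ (inj₂ (uJ , vO , _)))))))
    = inj₁ uJ , inj₂ vO , IsO-V⇒VU≤A21 vO

theorem1 : (n m : ℕ) (A : Mat n n) (B : Mat m m) (i : Fin n)
    (U : Mat m (toℕ i)) (V : Mat (n ∸ suc (toℕ i)) m) →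
    IsPosetMatrix n A → IsPosetMatrix m B →
    SevenCases A i U V →
    IsPosetMatrix (n + m ∸ 1) (blockMatrix A B i U V)
theorem1 n m A B i U V PA PB cases =
  blockMatrix-isPosetMatrix PA PB (sevenCases⇒admissible cases)
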